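{- Let $H$ be a $3$-hypergraph, let $\pi$ be a quasigraph in $H$, and let $X,Y\subseteq V(H)$ be such that $\pi$ is anticonnected on $X$ and anticonnected on $Y$. Then $\pi$ is anticonnected on $X\cup Y$ whenever one of the following holds: (i) $X\cap Y\neq\emptyset$; or (ii) there is a hyperedge $h$ of $H$ intersecting both $X$ and $Y$ such that $\pi(h)\subseteq X$ or $\pi(h)\subseteq Y$ (possibly $\pi(h)=\emptyset$).
   Context: A $3$-hypergraph is a finite hypergraph all of whose hyperedges have size $2$ or $3$. A quasigraph $\pi$ in $H$ is a map assigning to each hyperedge $e$ of $H$ either a $2$-element subset of $e$ or the empty set. For $X\subseteq V(H)$, $\pi$ is anticonnected on $X$ (in $H$) if for every partition $\mathcal R$ of $X$ with at least two classes there is a hyperedge $f$ of $H$ intersecting at least two classes of $\mathcal R$ such that $\pi(f)$ is a subset of one class of $\mathcal R$ (possibly $\pi(f)=\emptyset$). -}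

module Defs where

open import Data.Nat using (ℕ)
open import Data.Fin using (Fin)
open import Data.Fin.Subset using (Subset; _∈_; _⊆_; ∣_∣; ⊥; _∩_)
open import Data.Product using (Σ; ∃; ∃-syntax; _×_)
open import Data.Sum using (_⊎_)
open import Relation.Binary.PropositionalEquality using (_≡_; _≢_)
open import Function.Definitions using (Injective)

-- A 3-hypergraph on vertex set Fin n with m hyperedges, each hyperedge a
-- subset of the vertices of size 2 or 3; distinct indices give distinct
-- hyperedges (a hypergraph is a set of hyperedges).
record Hypergraph3 (n : ℕ) : Set where
  field
    m     : ℕ
    edge  : Fin m → Subset n
    size  : (e : Fin m) → (∣ edge e ∣ ≡ 2) ⊎ (∣ edge e ∣ ≡ 3)
    inj   : Injective _≡_ _≡_ edge

open Hypergraph3 public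

record Quasigraph {n : ℕ} (H : Hypergraph3 n) : Set where
  field
    π      : Fin (m H) → Subset n
    π-spec : (e : Fin (m H)) →
             ((π e ⊆ edge H e) × (∣ π e ∣ ≡ 2)) ⊎ (π e ≡ ⊥)

open Quasigraph public

-- A partition R of X is encoded by a class-labelling c : Fin n → ℕ;
-- the classes are the nonempty fibres { x ∈ X | c x ≡ k } (values of c
-- outside X are irrelevant).
TwoClasses : {n : ℕ} → Subset n → (Fin n → ℕ) → Set
TwoClasses X c = ∃[ x ] ∃[ y ] (x ∈ X × y ∈ X × c x ≢ c y)

MeetsTwo : {n : ℕ} → Subset n → (Fin n → ℕ) → Subset n → Set
MeetsTwo X c f = ∃[ x ] ∃[ y ] (x ∈ f × y ∈ f × x ∈ X × y ∈ X × c x ≢ c y)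

-- the set p is contained in a single class of the partition
-- (vacuous when p is empty)
InOneClass : {n : ℕ} → Subset n → (Fin n → ℕ) → Subset n → Set
InOneClass X c p = ∃[ k ] ((v : Fin _) → v ∈ p → (v ∈ X × c v ≡ k))

Anticonnected : {n : ℕ} (H : Hypergraph3 n) → Quasigraph H → Subset n → Set
Anticonnected H q X =
  (c : Fin _ → ℕ) → TwoClasses X c →
  ∃[ f ] (MeetsTwo X c (edge H f) × InOneClass X c (π q f))

-- Given a partition of X ∪ Y with at least two classes, if it already splits X
-- (or Y), the hyperedge certifying anticonnectedness on X (or Y) certifies it
-- on X ∪ Y as well. Otherwise X and Y each lie inside one class, and these
-- classes must differ. Under (i) they share a vertex, which is impossible; under
-- (ii) the hyperedge h meets both classes while π(h) lies inside one of them.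
module Submission where

open import Defs
open import Data.Nat using (ℕ; _≟_)
open import Data.Fin using (Fin)
open import Data.Fin.Subset using (Subset; _∪_; _∩_; _⊆_; Nonempty; _∈_)
open import Data.Fin.Subset.Properties using (_∈?_; x∈p∪q⁻; x∈p∩q⁻; p⊆p∪q; q⊆p∪q)
open import Data.Fin.Properties using (any?)
open import Data.Product using (∃-syntax; _×_; _,_; proj₁; proj₂)
open import Data.Sum using (_⊎_; inj₁; inj₂)
open import Relation.Nullary using (¬_; yes; no; ¬?; _×-dec_; contradiction)
open import Relation.Nullary.Decidable using (decidable-stable)
open import Relation.Binary.PropositionalEquality using (_≡_; _≢_; refl; sym; trans)

private
  variable
    n : ℕ

ConstantOn : Subset n → (Fin n → ℕ) → ℕ → Set
ConstantOn X c k = ∀ {v} → v ∈ X → c v ≡ k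

constantOn⊎twoClasses : (X : Subset n) (c : Fin n → ℕ) {a : Fin n} → a ∈ X →
                        ConstantOn X c (c a) ⊎ TwoClasses X c
constantOn⊎twoClasses X c {a} a∈X
  with any? (λ v → v ∈? X ×-dec ¬? (c v ≟ c a))
... | yes (v , v∈X , cv≢ca) = inj₂ (v , a , v∈X , a∈X , cv≢ca)
... | no ¬violation = inj₁ λ {v} v∈X →
  decidable-stable (c v ≟ c a) (λ cv≢ca → ¬violation (v , v∈X , cv≢ca))

constantOn-∪ : {X Y : Subset n} {c : Fin n → ℕ} {k : ℕ} →
               ConstantOn X c k → ConstantOn Y c k → ConstantOn (X ∪ Y) c k
constantOn-∪ {X = X} {Y} cX cY v∈X∪Y with x∈p∪q⁻ X Y v∈X∪Y
... | inj₁ v∈X = cX v∈X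
... | inj₂ v∈Y = cY v∈Y

constantOn⇒¬twoClasses : {X : Subset n} {c : Fin n → ℕ} {k : ℕ} →
                         ConstantOn X c k → ¬ TwoClasses X c
constantOn⇒¬twoClasses cX (x , y , x∈X , y∈X , cx≢cy) =
  cx≢cy (trans (cX x∈X) (sym (cX y∈X)))

twoClasses-∪⇒distinct : {X Y : Subset n} {c : Fin n → ℕ} {k l : ℕ} →
                        TwoClasses (X ∪ Y) c →
                        ConstantOn X c k → ConstantOn Y c l → k ≢ l
twoClasses-∪⇒distinct two cX cY refl = constantOn⇒¬twoClasses (constantOn-∪ cX cY) two

module _ {n : ℕ} (H : Hypergraph3 n) (q : Quasigraph H) where

  Certificate : Subset n → (Fin n → ℕ) → Set
  Certificate X c = ∃[ f ] (MeetsTwo X c (edge H f) × InOneClass X c (π q f))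

  certificate-mono : {X Z : Subset n} → X ⊆ Z → {c : Fin n → ℕ} →
                     Certificate X c → Certificate Z c
  certificate-mono X⊆Z (f , (x , y , x∈f , y∈f , x∈X , y∈X , cx≢cy) , (k , π⊆class)) =
    f , (x , y , x∈f , y∈f , X⊆Z x∈X , X⊆Z y∈X , cx≢cy) ,
    (k , λ v v∈π → X⊆Z (proj₁ (π⊆class v v∈π)) , proj₂ (π⊆class v v∈π))

  certificate-∪⊎constantOn : {X Y : Subset n} →
    Anticonnected H q X → Anticonnected H q Y →
    (c : Fin n → ℕ) {a b : Fin n} → a ∈ X → b ∈ Y →
    Certificate (X ∪ Y) c ⊎ (ConstantOn X c (c a) × ConstantOn Y c (c b))
  certificate-∪⊎constantOn {X} {Y} acX acY c a∈X b∈Y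
    with constantOn⊎twoClasses X c a∈X | constantOn⊎twoClasses Y c b∈Y
  ... | inj₂ twoX | _ = inj₁ (certificate-mono (p⊆p∪q Y) (acX c twoX))
  ... | inj₁ _ | inj₂ twoY = inj₁ (certificate-mono (q⊆p∪q X Y) (acY c twoY))
  ... | inj₁ cX | inj₁ cY = inj₂ (cX , cY)

  edge-certificate : {X Y : Subset n} {c : Fin n → ℕ} {k l : ℕ} (h : Fin (m H)) {a b : Fin n} →
    a ∈ edge H h → b ∈ edge H h → a ∈ X → b ∈ Y → c a ≢ c b →
    ConstantOn X c k → ConstantOn Y c l → (π q h ⊆ X) ⊎ (π q h ⊆ Y) →
    Certificate (X ∪ Y) c
  edge-certificate {X} {Y} {c} {k} {l} h {a} {b} a∈h b∈h a∈X b∈Y ca≢cb cX cY π⊆X⊎Y =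
    h , (a , b , a∈h , b∈h , p⊆p∪q Y a∈X , q⊆p∪q X Y b∈Y , ca≢cb) , inOneClass π⊆X⊎Y
    where
    inOneClass : (π q h ⊆ X) ⊎ (π q h ⊆ Y) → InOneClass (X ∪ Y) c (π q h)
    inOneClass (inj₁ π⊆X) = k , λ v v∈π → p⊆p∪q Y (π⊆X v∈π) , cX (π⊆X v∈π)
    inOneClass (inj₂ π⊆Y) = l , λ v v∈π → q⊆p∪q X Y (π⊆Y v∈π) , cY (π⊆Y v∈π)

lemma1 : {n : ℕ} (H : Hypergraph3 n) (q : Quasigraph H) (X Y : Subset n) →
    Anticonnected H q X → Anticonnected H q Y →
    (Nonempty (X ∩ Y)
      ⊎ (∃[ h ] (Nonempty (edge H h ∩ X) × Nonempty (edge H h ∩ Y)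
                 × ((π q h ⊆ X) ⊎ (π q h ⊆ Y))))) →
    Anticonnected H q (X ∪ Y)
lemma1 H q X Y acX acY (inj₁ (z , z∈X∩Y)) c two
  with zX , zY ← x∈p∩q⁻ X Y z∈X∩Y
  with certificate-∪⊎constantOn H q acX acY c zX zY
... | inj₁ cert = cert
... | inj₂ (cX , cY) = contradiction refl (twoClasses-∪⇒distinct two cX cY)
lemma1 H q X Y acX acY (inj₂ (h , (a , a∈h∩X) , (b , b∈h∩Y) , π⊆X⊎Y)) c two
  with a∈h , a∈X ← x∈p∩q⁻ (edge H h) X a∈h∩X
  with b∈h , b∈Y ← x∈p∩q⁻ (edge H h) Y b∈h∩Y
  with certificate-∪⊎constantOn H q acX acY c a∈X b∈Y
... | inj₁ cert = cert
... | inj₂ (cX , cY) =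
  edge-certificate H q h a∈h b∈h a∈X b∈Y (twoClasses-∪⇒distinct two cX cY) cX cY π⊆X⊎Y
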